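{- Let $x,y,z\in\mathbb{C}$ with $y+xz\neq0$, and let $\alpha=(\alpha_i)_{i\geq0}$, $\beta=(\beta_i)_{i\geq0}$ be complex sequences with $\alpha_0=\beta_0$. Define $\widetilde{\alpha}=(\widetilde{\alpha}_i)_{i\geq0}$ and $\widetilde{\beta}=(\widetilde{\beta}_i)_{i\geq0}$ by $\widetilde{\alpha}_0=\alpha_0$, $\widetilde{\alpha}_i=\alpha_i-\sum_{k=0}^{i-1}\binom{i}{k}z^{i-k}\widetilde{\alpha}_k$ for $i\geq1$, and $\widetilde{\beta}_0=\beta_0$, $\widetilde{\beta}_i=\bigl(\beta_i-\sum_{k=0}^{i-1}\binom{i}{k}x^{i-k}(y+xz)^k\widetilde{\beta}_k\bigr)/(y+xz)^i$ for $i\geq1$. Then \[ P_{\alpha,\beta}^{[x,y,z]}=P_{\lambda_z,\mu}^{[0,1,z]}\cdot P_{\widetilde{\alpha},\widetilde{\beta}}^{[0,1,0]}\cdot\bigl(P_{\lambda_x,\mu}^{[0,y+xz,x]}\bigr)^t, \] where each matrix is understood as its principal $n\times n$ submatrix, for any $n\geq1$.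
   Context: For complex numbers $x,y,z$ and complex sequences $\alpha=(\alpha_i)_{i\geq0}$, $\beta=(\beta_i)_{i\geq0}$ with $\alpha_0=\beta_0$, the weighted recurrence matrix $P_{\alpha,\beta}^{[x,y,z]}=[P_{i,j}]_{i,j\geq0}$ is the infinite matrix defined by $P_{i,0}=\alpha_i$, $P_{0,j}=\beta_j$ for $i,j\geq 0$, and $P_{i,j}=xP_{i,j-1}+yP_{i-1,j-1}+zP_{i-1,j}$ for $i,j\geq1$. In particular $P_{\widetilde{\alpha},\widetilde{\beta}}^{[0,1,0]}$ is the Toeplitz matrix with entries $\widetilde{\alpha}_{i-j}$ for $i\geq j$ and $\widetilde{\beta}_{j-i}$ for $j\geq i$. For $z\in\mathbb{C}$, $\lambda_z=(z^i)_{i\geq0}$ (with the convention $0^0=1$), and $\mu=(1,0,0,\ldots)$; thus $P_{\lambda_w,\mu}^{[0,v,w]}$ is the lower triangular matrix with entries $\binom{i}{j}v^jw^{i-j}$. $A^t$ denotes the transpose of $A$. -}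

module Defs where

open import Level using (_⊔_) renaming (suc to lsuc)
open import Data.Nat using (ℕ; zero; suc; _∸_; _<ᵇ_)
open import Data.Nat.Combinatorics using (_C_)
open import Data.Bool using (if_then_else_)
open import Relation.Nullary using (¬_)
open import Algebra.Bundles using (CommutativeRing)

-- A field: a commutative ring with 0 ≠ 1 in which every nonzero element
-- has a multiplicative inverse.  (ℂ is an instance; stdlib has no ℂ.)
record Field (c ℓ : Level.Level) : Set (lsuc (c ⊔ ℓ)) where
  field
    commutativeRing : CommutativeRing c ℓ
  open CommutativeRing commutativeRing public
  field
    inv      : (a : Carrier) → ¬ (a ≈ 0#) → Carrier
    inverseʳ : ∀ a (p : ¬ (a ≈ 0#)) → a * inv a p ≈ 1#
    0≉1      : ¬ (0# ≈ 1#)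

module FieldDefs {c ℓ} (F : Field c ℓ) where
  open Field F using (Carrier; _≈_; _+_; _*_; _-_; 0#; 1#; inv)

  Seq : Set c
  Seq = ℕ → Carrier

  Mat : Set c
  Mat = ℕ → ℕ → Carrier

  fromℕ : ℕ → Carrier
  fromℕ zero    = 0#
  fromℕ (suc n) = 1# + fromℕ n

  -- power, with a ^ 0 = 1 (so 0^0 = 1)
  pow : Carrier → ℕ → Carrier
  pow a zero    = 1#
  pow a (suc n) = a * pow a n

  sumTo : ℕ → (ℕ → Carrier) → Carrier
  sumTo zero    f = 0#
  sumTo (suc n) f = sumTo n f + f n

  -- weighted recurrence matrix P^{[x,y,z]}_{α,β}
  -- (the hypothesis α 0 = β 0 is assumed separately; entry (0,0) is α 0)
  P : Carrier → Carrier → Carrier → Seq → Seq → Mat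
  P x y z α β i       zero    = α i
  P x y z α β zero    (suc j) = β (suc j)
  P x y z α β (suc i) (suc j) =
    x * P x y z α β (suc i) j + y * P x y z α β i j + z * P x y z α β i (suc j)

  lam : Carrier → Seq
  lam a i = pow a i

  mu : Seq
  mu zero    = 1#
  mu (suc i) = 0#

  transpose : Mat → Mat
  transpose A i j = A j i

  -- product of the principal n×n submatrices (entries with i,j < n are meaningful)
  mul : ℕ → Mat → Mat → Mat
  mul n A B i j = sumTo n (λ k → A i k * B k j)

  -- course-of-values recursion: step m t computes the m-th term from
  -- the earlier terms t k (k < m)
  covTable : (ℕ → Seq → Carrier) → ℕ → Seq
  covTable step zero    = λ _ → 0#
  covTable step (suc m) = λ k →
    if k <ᵇ m then covTable step m k else step m (covTable step m)

  cov : (ℕ → Seq → Carrier) → Seq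
  cov step i = covTable step (suc i) i

  alphaTilde : Carrier → Seq → Seq
  alphaTilde z α = cov step
    where
    step : ℕ → Seq → Carrier
    step zero    t = α zero
    step (suc m) t = α (suc m) -
      sumTo (suc m) (λ k → fromℕ (suc m C k) * pow z (suc m ∸ k) * t k)

  betaTilde : (x y z : Carrier) → ¬ (y + x * z ≈ 0#) → Seq → Seq
  betaTilde x y z nz β = cov step
    where
    d : Carrier
    d = y + x * z
    step : ℕ → Seq → Carrier
    step zero    t = β zero
    step (suc m) t =
      (β (suc m) -
        sumTo (suc m) (λ k → fromℕ (suc m C k) * pow x (suc m ∸ k) * pow d k * t k))
      * pow (inv d nz) (suc m)

{-# OPTIONS --safe #-}
-- Write L, T, R for the three factors and M = L T Rᵗ.  The rows of the binomial matrices obey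
-- L(i+1,k) = z L(i,k) + L(i,k-1) and R(j+1,l) = x R(j,l) + (y+xz) R(j,l-1), while the Toeplitz
-- factor is invariant under the diagonal shift.  Hence M(i+1,j) = z M(i,j) + M↑(i,j), where M↑
-- uses the rows of T shifted up, and M↑(i,j+1) = x M↑(i,j) + (y+xz) M(i,j); eliminating M↑
-- gives M(i+1,j+1) = x M(i+1,j) + y M(i,j) + z M(i,j+1).  The first column of M is L α̃ = α and
-- its first row is R β̃ = β, which is exactly the triangular system defining α̃ and β̃.  A matrix
-- is determined on the n×n block by its first row, first column and this recurrence.
module Submission where

open import Defs
open import Data.Bool using (true; false; if_then_else_)
open import Data.Empty using (⊥-elim)
open import Data.Nat using () renaming (_+_ to _+ℕ_)
open import Data.Nat using (ℕ; zero; suc; _∸_; _<ᵇ_; _<_; _≤_; _≥_; z≤n; s≤s; s≤s⁻¹)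
open import Data.Nat.Combinatorics using (_C_; nCn≡1; k>n⇒nCk≡0; nCk+nC[k+1]≡[n+1]C[k+1])
open import Data.Nat.Properties
  using (<ᵇ-reflects-<; m≤n⇒m<n∨m≡n; <-≤-connex; +-∸-assoc; n∸n≡0; <⇒≤; m<n⇒m<1+n;
         ≤-refl; ≤-trans; n≤1+n)
open import Data.Sum using (inj₁; inj₂)
open import Relation.Nullary using (¬_)
open import Relation.Nullary.Reflects using (ofʸ; ofⁿ)
import Relation.Binary.PropositionalEquality as ≡
import Relation.Binary.Reasoning.Setoid as SetoidReasoning
import Algebra.Properties.AbelianGroup as AbelianGroupProperties

<ᵇ-irrefl : ∀ n → (n <ᵇ n) ≡.≡ false
<ᵇ-irrefl zero    = ≡.refl
<ᵇ-irrefl (suc n) = <ᵇ-irrefl n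

module _ {c ℓ} (F : Field c ℓ) where
  open Field F
  open FieldDefs F
  open SetoidReasoning setoid
  open AbelianGroupProperties +-abelianGroup using (xyx⁻¹≈y)
  open import Algebra.Solver.Ring.NaturalCoefficients.Default commutativeSemiring
    using (solve; _:+_; _:*_; _:=_; con)

  +-minus-cancel : ∀ a b → a + (b - a) ≈ b
  +-minus-cancel a b = trans (sym (+-assoc a b (- a))) (xyx⁻¹≈y a b)

  fromℕ-+ : ∀ m n → fromℕ (m +ℕ n) ≈ fromℕ m + fromℕ n
  fromℕ-+ zero    n = sym (+-identityˡ _)
  fromℕ-+ (suc m) n = trans (+-cong refl (fromℕ-+ m n)) (sym (+-assoc _ _ _))

  pow-1# : ∀ k → pow 1# k ≈ 1#
  pow-1# zero    = refl
  pow-1# (suc k) = trans (*-identityˡ _) (pow-1# k)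

  pow-inverse : ∀ {a b} → a * b ≈ 1# → ∀ k → pow a k * pow b k ≈ 1#
  pow-inverse ab≈1 zero    = *-identityˡ 1#
  pow-inverse {a} {b} ab≈1 (suc k) = begin
    a * pow a k * (b * pow b k)
      ≈⟨ solve 4 (λ a b p q → a :* p :* (b :* q) := a :* b :* (p :* q)) refl a b _ _ ⟩
    a * b * (pow a k * pow b k)     ≈⟨ *-cong ab≈1 (pow-inverse ab≈1 k) ⟩
    1# * 1#                         ≈⟨ *-identityˡ 1# ⟩
    1#                              ∎

  sumTo-cong : ∀ n {f g : Seq} → (∀ k → k < n → f k ≈ g k) → sumTo n f ≈ sumTo n g
  sumTo-cong zero    f≈g = refl
  sumTo-cong (suc n) f≈g = +-cong (sumTo-cong n (λ k k<n → f≈g k (m<n⇒m<1+n k<n))) (f≈g n ≤-refl)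

  sumTo-+ : ∀ n (f g : Seq) → sumTo n (λ k → f k + g k) ≈ sumTo n f + sumTo n g
  sumTo-+ zero    f g = sym (+-identityʳ 0#)
  sumTo-+ (suc n) f g = trans (+-cong (sumTo-+ n f g) refl)
    (solve 4 (λ a b p q → a :+ b :+ (p :+ q) := a :+ p :+ (b :+ q)) refl _ _ _ _)

  sumTo-*ˡ : ∀ n a (f : Seq) → sumTo n (λ k → a * f k) ≈ a * sumTo n f
  sumTo-*ˡ zero    a f = sym (zeroʳ a)
  sumTo-*ˡ (suc n) a f = trans (+-cong (sumTo-*ˡ n a f) refl) (sym (distribˡ a _ _))

  sumTo-zero : ∀ n {f : Seq} → (∀ k → f k ≈ 0#) → sumTo n f ≈ 0#
  sumTo-zero zero    f≈0 = refl
  sumTo-zero (suc n) f≈0 = trans (+-cong (sumTo-zero n f≈0) (f≈0 n)) (+-identityʳ 0#)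

  sumTo-unfoldˡ : ∀ n (f : Seq) → sumTo (suc n) f ≈ f 0 + sumTo n (λ k → f (suc k))
  sumTo-unfoldˡ zero    f = +-comm 0# (f 0)
  sumTo-unfoldˡ (suc n) f = trans (+-cong (sumTo-unfoldˡ n f) refl) (+-assoc _ _ _)

  sumTo-truncate : ∀ {m n} {f : Seq} → m ≤ n → (∀ k → m ≤ k → f k ≈ 0#) → sumTo n f ≈ sumTo m f
  sumTo-truncate {n = zero}  z≤n _ = refl
  sumTo-truncate {m} {suc n} m≤1+n f≈0 with m≤n⇒m<n∨m≡n m≤1+n
  ... | inj₁ (s≤s m≤n) = trans (+-cong (sumTo-truncate m≤n f≈0) (f≈0 n m≤n)) (+-identityʳ _)
  ... | inj₂ ≡.refl    = refl

  cov-unfold : ∀ step m → cov step m ≡.≡ step m (covTable step m)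
  cov-unfold step m = ≡.cong (λ b → if b then covTable step m m else step m (covTable step m)) (<ᵇ-irrefl m)

  covTable-agrees : ∀ step {m k} → k < m → covTable step m k ≡.≡ cov step k
  covTable-agrees step {suc m} {k} k<1+m with k <ᵇ m | <ᵇ-reflects-< k m
  ... | true  | ofʸ k<m = covTable-agrees step k<m
  ... | false | ofⁿ k≮m with m≤n⇒m<n∨m≡n (s≤s⁻¹ k<1+m)
  ...   | inj₁ k<m    = ⊥-elim (k≮m k<m)
  ...   | inj₂ ≡.refl = ≡.sym (cov-unfold step k)

  cov-fixpoint : ∀ step m → (∀ {t u : Seq} → (∀ k → k < m → t k ≈ u k) → step m t ≈ step m u) →
                 cov step m ≈ step m (cov step)
  cov-fixpoint step m step-cong =
    trans (reflexive (cov-unfold step m)) (step-cong (λ k k<m → reflexive (covTable-agrees step k<m)))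

  binomialMatrix : Carrier → Carrier → Mat
  binomialMatrix v w = P 0# v w (lam w) mu

  module _ (a b : Carrier) where
    private
      B : Mat
      B = binomialMatrix a b

    binomialMatrix-pascal : ∀ i k → B (suc i) (suc k) ≈ b * B i (suc k) + a * B i k
    binomialMatrix-pascal i k =
      solve 5 (λ X Y Z a b → con 0 :* X :+ a :* Y :+ b :* Z := b :* Z :+ a :* Y) refl _ _ _ a b

    binomialMatrix-entry : ∀ i k → B i k ≈ fromℕ (i C k) * pow a k * pow b (i ∸ k)
    binomialMatrix-entry i zero =
      sym (solve 1 (λ p → (con 1 :+ con 0) :* con 1 :* p := p) refl (pow b i))
    binomialMatrix-entry zero (suc k) =
      sym (solve 2 (λ p q → con 0 :* p :* q := con 0) refl _ _)
    binomialMatrix-entry (suc i) (suc k) = begin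
      B (suc i) (suc k)
        ≈⟨ binomialMatrix-pascal i k ⟩
      b * B i (suc k) + a * B i k
        ≈⟨ +-cong (*-cong refl (binomialMatrix-entry i (suc k))) (*-cong refl (binomialMatrix-entry i k)) ⟩
      b * (fromℕ (i C suc k) * pow a (suc k) * pow b (i ∸ suc k)) + a * (fromℕ (i C k) * pow a k * pow b (i ∸ k))
        ≈⟨ +-cong (b-absorb (pow a (suc k)))
                  (solve 4 (λ a c p q → a :* (c :* p :* q) := c :* (a :* p) :* q) refl a _ _ _) ⟩
      fromℕ (i C suc k) * pow a (suc k) * pow b (i ∸ k) + fromℕ (i C k) * pow a (suc k) * pow b (i ∸ k)
        ≈⟨ solve 4 (λ c c′ p q → c′ :* p :* q :+ c :* p :* q := (c :+ c′) :* p :* q) refl _ _ _ _ ⟩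
      (fromℕ (i C k) + fromℕ (i C suc k)) * pow a (suc k) * pow b (i ∸ k)
        ≈⟨ *-cong (*-cong (sym (fromℕ-+ (i C k) (i C suc k))) refl) refl ⟩
      fromℕ (i C k +ℕ i C suc k) * pow a (suc k) * pow b (i ∸ k)
        ≡⟨ ≡.cong (λ c → fromℕ c * pow a (suc k) * pow b (i ∸ k)) (nCk+nC[k+1]≡[n+1]C[k+1] i k) ⟩
      fromℕ (suc i C suc k) * pow a (suc k) * pow b (i ∸ k) ∎
      where
      -- i ∸ k ≡ 1 + (i ∸ suc k) only when k < i; otherwise i C suc k vanishes.
      b-absorb : ∀ p → b * (fromℕ (i C suc k) * p * pow b (i ∸ suc k)) ≈ fromℕ (i C suc k) * p * pow b (i ∸ k)
      b-absorb p with <-≤-connex k i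
      ... | inj₁ k<i rewrite +-∸-assoc 1 k<i =
        solve 4 (λ b c p q → b :* (c :* p :* q) := c :* p :* (b :* q)) refl b _ p _
      ... | inj₂ i≤k rewrite k>n⇒nCk≡0 (s≤s i≤k) =
        solve 4 (λ b p q q′ → b :* (con 0 :* p :* q) := con 0 :* p :* q′) refl b p _ _

    binomialMatrix-upper : ∀ {i k} → i < k → B i k ≈ 0#
    binomialMatrix-upper {i} {k} i<k = begin
      B i k                                       ≈⟨ binomialMatrix-entry i k ⟩
      fromℕ (i C k) * pow a k * pow b (i ∸ k)
        ≡⟨ ≡.cong (λ c → fromℕ c * pow a k * pow b (i ∸ k)) (k>n⇒nCk≡0 i<k) ⟩
      0# * pow a k * pow b (i ∸ k)                ≈⟨ solve 2 (λ p q → con 0 :* p :* q := con 0) refl _ _ ⟩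
      0#                                          ∎

    binomialMatrix-diagonal : ∀ i → B i i ≈ pow a i
    binomialMatrix-diagonal i = begin
      B i i                                       ≈⟨ binomialMatrix-entry i i ⟩
      fromℕ (i C i) * pow a i * pow b (i ∸ i)
        ≡⟨ ≡.cong₂ (λ c e → fromℕ c * pow a i * pow b e) (nCn≡1 i) (n∸n≡0 i) ⟩
      (1# + 0#) * pow a i * 1#                    ≈⟨ solve 1 (λ p → (con 1 :+ con 0) :* p :* con 1 := p) refl _ ⟩
      pow a i                                     ∎

    binomialMatrix-row₀-sum : ∀ {n} (f : Seq) → 0 < n → sumTo n (λ k → B 0 k * f k) ≈ f 0
    binomialMatrix-row₀-sum {suc n} f _ = begin
      sumTo (suc n) (λ k → B 0 k * f k)           ≈⟨ sumTo-unfoldˡ n _ ⟩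
      1# * f 0 + sumTo n (λ k → 0# * f (suc k))   ≈⟨ +-cong (*-identityˡ _) (sumTo-zero n (λ k → zeroˡ _)) ⟩
      f 0 + 0#                                    ≈⟨ +-identityʳ _ ⟩
      f 0                                         ∎

    binomialMatrix-truncate : ∀ {i n} (f : Seq) → i < n →
      sumTo n (λ k → B i k * f k) ≈ sumTo (suc i) (λ k → B i k * f k)
    binomialMatrix-truncate f i<n =
      sumTo-truncate i<n (λ k i<k → trans (*-cong (binomialMatrix-upper i<k) refl) (zeroˡ _))

    binomialMatrix-row-sum : ∀ {i n} (f : Seq) → suc i < n →
      sumTo n (λ k → B (suc i) k * f k) ≈
        b * sumTo n (λ k → B i k * f k) + a * sumTo n (λ k → B i k * f (suc k))
    binomialMatrix-row-sum {i} {suc n} f (s≤s i<n) = begin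
      sumTo (suc n) (λ k → B (suc i) k * f k)
        ≈⟨ sumTo-unfoldˡ n _ ⟩
      b * B i 0 * f 0 + sumTo n (λ k → B (suc i) (suc k) * f (suc k))
        ≈⟨ +-cong (*-assoc b _ _) (sumTo-cong n (λ k _ → pascal-* k)) ⟩
      b * (B i 0 * f 0) + sumTo n (λ k → b * (B i (suc k) * f (suc k)) + a * g k)
        ≈⟨ +-cong refl (trans (sumTo-+ n _ _) (+-cong (sumTo-*ˡ n b _) (sumTo-*ˡ n a g))) ⟩
      b * (B i 0 * f 0) + (b * sumTo n (λ k → B i (suc k) * f (suc k)) + a * sumTo n g)
        ≈⟨ solve 5 (λ a b p q r → b :* p :+ (b :* q :+ a :* r) := b :* (p :+ q) :+ a :* r) refl a b _ _ _ ⟩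
      b * (B i 0 * f 0 + sumTo n (λ k → B i (suc k) * f (suc k))) + a * sumTo n g
        ≈⟨ +-cong (*-cong refl (sym (sumTo-unfoldˡ n _))) (*-cong refl (sym (sumTo-truncate (n≤1+n n) g≈0))) ⟩
      b * sumTo (suc n) (λ k → B i k * f k) + a * sumTo (suc n) g ∎
      where
      g : Seq
      g k = B i k * f (suc k)
      g≈0 : ∀ k → n ≤ k → g k ≈ 0#
      g≈0 k n≤k = trans (*-cong (binomialMatrix-upper (≤-trans i<n n≤k)) refl) (zeroˡ _)
      pascal-* : ∀ k → B (suc i) (suc k) * f (suc k) ≈ b * (B i (suc k) * f (suc k)) + a * g k
      pascal-* k = trans (*-cong (binomialMatrix-pascal i k) refl)
        (solve 5 (λ a b p q r → (b :* p :+ a :* q) :* r := b :* (p :* r) :+ a :* (q :* r)) refl a b _ _ _)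

  toeplitz-diagonal : ∀ (a b : Seq) k l → P 0# 1# 0# a b (suc k) (suc l) ≈ P 0# 1# 0# a b k l
  toeplitz-diagonal a b k l = solve 3 (λ X Y Z → con 0 :* X :+ con 1 :* Y :+ con 0 :* Z := Y) refl _ _ _

  P-unique : ∀ {x y z} {α β : Seq} n (M : Mat) →
    (∀ i → i < n → M i 0 ≈ α i) → (∀ j → j < n → M 0 j ≈ β j) →
    (∀ i j → suc i < n → suc j < n → M (suc i) (suc j) ≈ x * M (suc i) j + y * M i j + z * M i (suc j)) →
    ∀ i j → i < n → j < n → P x y z α β i j ≈ M i j
  P-unique n M column₀ row₀ recurrence i zero i<n _ = sym (column₀ i i<n)
  P-unique n M column₀ row₀ recurrence zero (suc j) _ j<n = sym (row₀ (suc j) j<n)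
  P-unique {x} {y} {z} {α} {β} n M column₀ row₀ recurrence (suc i) (suc j) i+1<n j+1<n =
    trans (+-cong (+-cong (*-cong refl (agree (suc i) j i+1<n (<⇒≤ j+1<n)))
                          (*-cong refl (agree i j (<⇒≤ i+1<n) (<⇒≤ j+1<n))))
                  (*-cong refl (agree i (suc j) (<⇒≤ i+1<n) j+1<n)))
          (sym (recurrence i j i+1<n j+1<n))
    where
    agree : ∀ i j → i < n → j < n → P x y z α β i j ≈ M i j
    agree = P-unique n M column₀ row₀ recurrence

  alphaTilde-suc : ∀ z (α : Seq) m → alphaTilde z α (suc m) ≈
    α (suc m) - sumTo (suc m) (λ k → fromℕ (suc m C k) * pow z (suc m ∸ k) * alphaTilde z α k)
  alphaTilde-suc z α m = cov-fixpoint _ (suc m)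
    (λ t≈u → +-cong refl (-‿cong (sumTo-cong (suc m) (λ k k<m → *-cong refl (t≈u k k<m)))))

  betaTilde-suc : ∀ x y z nz (β : Seq) m → betaTilde x y z nz β (suc m) ≈
    (β (suc m) - sumTo (suc m) (λ k → fromℕ (suc m C k) * pow x (suc m ∸ k) * pow (y + x * z) k
                                      * betaTilde x y z nz β k))
      * pow (inv (y + x * z) nz) (suc m)
  betaTilde-suc x y z nz β m = cov-fixpoint _ (suc m)
    (λ t≈u → *-cong (+-cong refl (-‿cong (sumTo-cong (suc m) (λ k k<m → *-cong refl (t≈u k k<m))))) refl)

  alphaTilde-inverts : ∀ z (α : Seq) i → sumTo (suc i) (λ k → binomialMatrix 1# z i k * alphaTilde z α k) ≈ α i
  alphaTilde-inverts z α zero    = trans (+-identityˡ _) (*-identityˡ _)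
  alphaTilde-inverts z α (suc i) = begin
    sumTo (suc i) (λ k → L (suc i) k * alphaTilde z α k) + L (suc i) (suc i) * alphaTilde z α (suc i)
      ≈⟨ +-cong (sumTo-cong (suc i) (λ k _ → *-cong (L-entry k) refl))
                (*-cong (trans (binomialMatrix-diagonal 1# z (suc i)) (pow-1# (suc i))) (alphaTilde-suc z α i)) ⟩
    S + 1# * (α (suc i) - S)  ≈⟨ +-cong refl (*-identityˡ _) ⟩
    S + (α (suc i) - S)       ≈⟨ +-minus-cancel S _ ⟩
    α (suc i)                 ∎
    where
    L : Mat
    L = binomialMatrix 1# z
    S : Carrier
    S = sumTo (suc i) (λ k → fromℕ (suc i C k) * pow z (suc i ∸ k) * alphaTilde z α k)
    L-entry : ∀ k → L (suc i) k ≈ fromℕ (suc i C k) * pow z (suc i ∸ k)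
    L-entry k = trans (binomialMatrix-entry 1# z (suc i) k)
                      (*-cong (trans (*-cong refl (pow-1# k)) (*-identityʳ _)) refl)

  betaTilde-inverts : ∀ x y z nz (β : Seq) j →
    sumTo (suc j) (λ l → binomialMatrix (y + x * z) x j l * betaTilde x y z nz β l) ≈ β j
  betaTilde-inverts x y z nz β zero    = trans (+-identityˡ _) (*-identityˡ _)
  betaTilde-inverts x y z nz β (suc j) = begin
    sumTo (suc j) (λ l → R (suc j) l * betaTilde x y z nz β l) + R (suc j) (suc j) * betaTilde x y z nz β (suc j)
      ≈⟨ +-cong (sumTo-cong (suc j) (λ l _ → *-cong (R-entry l) refl))
                (*-cong (binomialMatrix-diagonal d x (suc j)) (betaTilde-suc x y z nz β j)) ⟩
    S + pow d (suc j) * ((β (suc j) - S) * pow (inv d nz) (suc j))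
      ≈⟨ +-cong refl (solve 3 (λ p q r → p :* (q :* r) := q :* (p :* r)) refl _ _ _) ⟩
    S + (β (suc j) - S) * (pow d (suc j) * pow (inv d nz) (suc j))
      ≈⟨ +-cong refl (*-cong refl (pow-inverse (inverseʳ d nz) (suc j))) ⟩
    S + (β (suc j) - S) * 1#  ≈⟨ +-cong refl (*-identityʳ _) ⟩
    S + (β (suc j) - S)       ≈⟨ +-minus-cancel S _ ⟩
    β (suc j)                 ∎
    where
    d : Carrier
    d = y + x * z
    R : Mat
    R = binomialMatrix d x
    S : Carrier
    S = sumTo (suc j) (λ l → fromℕ (suc j C l) * pow x (suc j ∸ l) * pow d l * betaTilde x y z nz β l)
    R-entry : ∀ l → R (suc j) l ≈ fromℕ (suc j C l) * pow x (suc j ∸ l) * pow d l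
    R-entry l = trans (binomialMatrix-entry d x (suc j) l)
                      (solve 3 (λ c p q → c :* p :* q := c :* q :* p) refl _ _ _)

  module Factorisation (x y z : Carrier) (nz : ¬ (y + x * z ≈ 0#)) (α β : Seq) (α₀≈β₀ : α 0 ≈ β 0)
                       (n : ℕ) where
    d : Carrier
    d = y + x * z

    L R T T↑ : Mat
    L = binomialMatrix 1# z
    R = binomialMatrix d x
    T = P 0# 1# 0# (alphaTilde z α) (betaTilde x y z nz β)
    T↑ k l = T (suc k) l

    LT LT↑ M M↑ : Mat
    LT = mul n L T
    LT↑ = mul n L T↑
    M = mul n LT (transpose R)
    M↑ = mul n LT↑ (transpose R)

    M-row-step : ∀ {i} j → suc i < n → M (suc i) j ≈ z * M i j + M↑ i j
    M-row-step {i} j i+1<n = begin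
      sumTo n (λ l → LT (suc i) l * R j l)
        ≈⟨ sumTo-cong n (λ l _ → *-cong (binomialMatrix-row-sum 1# z (λ k → T k l) i+1<n) refl) ⟩
      sumTo n (λ l → (z * LT i l + 1# * LT↑ i l) * R j l)
        ≈⟨ sumTo-cong n (λ l _ →
             solve 4 (λ z p q r → (z :* p :+ con 1 :* q) :* r := z :* (p :* r) :+ q :* r) refl z _ _ _) ⟩
      sumTo n (λ l → z * (LT i l * R j l) + LT↑ i l * R j l)
        ≈⟨ trans (sumTo-+ n _ _) (+-cong (sumTo-*ˡ n z _) refl) ⟩
      z * M i j + M↑ i j ∎

    M↑-column-step : ∀ i {j} → suc j < n → M↑ i (suc j) ≈ x * M↑ i j + d * M i j
    M↑-column-step i {j} j+1<n = begin
      sumTo n (λ l → LT↑ i l * R (suc j) l)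
        ≈⟨ sumTo-cong n (λ l _ → *-comm _ _) ⟩
      sumTo n (λ l → R (suc j) l * LT↑ i l)
        ≈⟨ binomialMatrix-row-sum d x (LT↑ i) j+1<n ⟩
      x * sumTo n (λ l → R j l * LT↑ i l) + d * sumTo n (λ l → R j l * LT↑ i (suc l))
        ≈⟨ +-cong (*-cong refl (sumTo-cong n (λ l _ → *-comm _ _)))
                  (*-cong refl (sumTo-cong n (λ l _ → trans (*-comm _ _) (*-cong (LT↑-diagonal l) refl)))) ⟩
      x * M↑ i j + d * M i j ∎
      where
      LT↑-diagonal : ∀ l → LT↑ i (suc l) ≈ LT i l
      LT↑-diagonal l = sumTo-cong n (λ k _ → *-cong refl (toeplitz-diagonal _ _ k l))

    M-recurrence : ∀ i j → suc i < n → suc j < n →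
      M (suc i) (suc j) ≈ x * M (suc i) j + y * M i j + z * M i (suc j)
    M-recurrence i j i+1<n j+1<n = begin
      M (suc i) (suc j)                                      ≈⟨ M-row-step (suc j) i+1<n ⟩
      z * M i (suc j) + M↑ i (suc j)                         ≈⟨ +-cong refl (M↑-column-step i j+1<n) ⟩
      z * M i (suc j) + (x * M↑ i j + (y + x * z) * M i j)
        ≈⟨ solve 6 (λ x y z p q r → z :* r :+ (x :* q :+ (y :+ x :* z) :* p)
                                  := x :* (z :* p :+ q) :+ y :* p :+ z :* r) refl x y z _ _ _ ⟩
      x * (z * M i j + M↑ i j) + y * M i j + z * M i (suc j)
        ≈⟨ +-cong (+-cong (*-cong refl (sym (M-row-step j i+1<n))) refl) refl ⟩
      x * M (suc i) j + y * M i j + z * M i (suc j)          ∎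

    M-column₀ : ∀ i → i < n → M i 0 ≈ α i
    M-column₀ i i<n = begin
      sumTo n (λ l → LT i l * R 0 l)                   ≈⟨ sumTo-cong n (λ l _ → *-comm _ _) ⟩
      sumTo n (λ l → R 0 l * LT i l)                   ≈⟨ binomialMatrix-row₀-sum d x (LT i) 0<n ⟩
      sumTo n (λ k → L i k * alphaTilde z α k)         ≈⟨ binomialMatrix-truncate 1# z _ i<n ⟩
      sumTo (suc i) (λ k → L i k * alphaTilde z α k)   ≈⟨ alphaTilde-inverts z α i ⟩
      α i                                              ∎
      where
      0<n : 0 < n
      0<n = ≤-trans (s≤s z≤n) i<n

    M-row₀ : ∀ j → j < n → M 0 j ≈ β j
    M-row₀ j j<n = begin
      sumTo n (λ l → LT 0 l * R j l)
        ≈⟨ sumTo-cong n (λ l _ → trans (*-comm _ _) (*-cong refl (LT-row₀ l))) ⟩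
      sumTo n (λ l → R j l * betaTilde x y z nz β l)               ≈⟨ binomialMatrix-truncate d x _ j<n ⟩
      sumTo (suc j) (λ l → R j l * betaTilde x y z nz β l)         ≈⟨ betaTilde-inverts x y z nz β j ⟩
      β j                                                          ∎
      where
      T-row₀ : ∀ l → T 0 l ≈ betaTilde x y z nz β l
      T-row₀ zero    = α₀≈β₀
      T-row₀ (suc l) = refl
      LT-row₀ : ∀ l → LT 0 l ≈ betaTilde x y z nz β l
      LT-row₀ l = trans (binomialMatrix-row₀-sum 1# z (λ k → T k l) (≤-trans (s≤s z≤n) j<n)) (T-row₀ l)

corollary1 : ∀ {c ℓ} (F : Field c ℓ) →
    let open Field F in let open FieldDefs F in
    (x y z : Carrier) (nz : ¬ (y + x * z ≈ 0#)) (α β : Seq) → α 0 ≈ β 0 →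
    (n : ℕ) → n ≥ 1 → (i j : ℕ) → i < n → j < n →
    P x y z α β i j ≈
      mul n (mul n (P 0# 1# z (lam z) mu) (P 0# 1# 0# (alphaTilde z α) (betaTilde x y z nz β)))
        (transpose (P 0# (y + x * z) x (lam x) mu)) i j
corollary1 F x y z nz α β α₀≈β₀ n _ = P-unique F n M M-column₀ M-row₀ M-recurrence
  where open Factorisation F x y z nz α β α₀≈β₀ n
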